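{- For every $\tau\in\mathbb{G}_\infty$ the limit $j(\tau):=\lim_{k\to\infty}j_k(p_k(\tau))$ exists.
   Context: For $k\in\mathbb{N}$ let $\mathbb{G}_k=(\mathbb{Z}/2\mathbb{Z})^k$ with $\sigma\cdot\tau=\sum_{i=1}^k\sigma_i\tau_i$. Define $\hat h_k,\hat r_k:\{0,\dots,2^k\}\to\mathbb{N}_0$ recursively by $\hat h_0(0)=\hat h_0(1)=1$, $\hat r_0(0)=0$, $\hat r_0(1)=1$, and for $s\in\{0,\dots,2^k\}$: $\hat h_{k+1}(2s)=\hat h_k(s)$, $\hat r_{k+1}(2s)=\hat r_k(s)$; for $s\in\{0,\dots,2^k-1\}$: $\hat h_{k+1}(2s+1)=\hat h_k(s)+\hat h_k(s+1)$, $\hat r_{k+1}(2s+1)=\hat r_k(s)+\hat r_k(s+1)$. The Farey function is $F_k(\sigma)=\hat r_k(s)/\hat h_k(s)$ with $s=\sum_{i=1}^k\sigma_i2^{k-i}$, and $j_k(\tau)=-2^{ -k}\sum_{\sigma\in\mathbb{G}_k}(-1)^{\sigma\cdot\tau}F_k(\sigma)$. Let $\mathbb{G}_\infty=\bigoplus_{\mathbb{N}}\mathbb{Z}/2\mathbb{Z}$ (0/1-sequences $(\tau_i)_{i\ge1}$ with finitely many nonzero entries) and $p_k(\tau)=(\tau_1,\dots,\tau_k)$. -}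

module Defs where

open import Data.Bool using (Bool; true; false; if_then_else_; _xor_; _∧_)
open import Data.Nat using (ℕ; zero; suc; _+_; _^_; _≤_; ⌊_/2⌋)
open import Data.Integer using (+_)
open import Data.Rational using (ℚ; 0ℚ; _/_; -_; ∣_∣) renaming (_+_ to _+ℚ_; _*_ to _*ℚ_; _-_ to _-ℚ_; _<_ to _<ℚ_)
open import Data.Product using (_×_; _,_; proj₁; proj₂; Σ; ∃)
open import Data.List using (List; []; _∷_; map; _++_; foldr)
open import Data.Vec using (Vec; []; _∷_; tabulate)
open import Data.Fin using (Fin; toℕ)
open import Relation.Binary.PropositionalEquality using (_≡_)

G : ℕ → Set
G k = Vec Bool k

isOdd : ℕ → Bool
isOdd zero = false
isOdd (suc n) with isOdd n
... | true = false
... | false = true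

-- (ĥ_k(s) , r̂_k(s)); values for s > 2^k are irrelevant junk
hr : ℕ → ℕ → ℕ × ℕ
hr zero zero = 1 , 0
hr zero (suc zero) = 1 , 1
hr zero (suc (suc _)) = 1 , 0
hr (suc k) s with isOdd s
... | false = hr k ⌊ s /2⌋
... | true  = proj₁ (hr k ⌊ s /2⌋) + proj₁ (hr k (suc ⌊ s /2⌋))
            , proj₂ (hr k ⌊ s /2⌋) + proj₂ (hr k (suc ⌊ s /2⌋))

hhat : ℕ → ℕ → ℕ
hhat k s = proj₁ (hr k s)

rhat : ℕ → ℕ → ℕ
rhat k s = proj₂ (hr k s)

-- s = Σ σ_i 2^{k-i}  (σ₁ most significant)
toNat : ∀ {k} → G k → ℕ
toNat [] = 0
toNat {suc k} (b ∷ bs) = (if b then 2 ^ k else 0) + toNat bs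

-- r / h as a rational (h is always ≥ 1 for the values used; h = 0 branch is junk)
divℕ : ℕ → ℕ → ℚ
divℕ r zero = 0ℚ
divℕ r (suc h) = (+ r) / suc h

F : (k : ℕ) → G k → ℚ
F k σ = divℕ (rhat k (toNat σ)) (hhat k (toNat σ))

dot : ∀ {k} → G k → G k → Bool
dot [] [] = false
dot (a ∷ as) (b ∷ bs) = (a ∧ b) xor dot as bs

allG : (k : ℕ) → List (G k)
allG zero = [] ∷ []
allG (suc k) = map (false ∷_) (allG k) ++ map (true ∷_) (allG k)

sumℚ : List ℚ → ℚ
sumℚ = foldr _+ℚ_ 0ℚ

signed : Bool → ℚ → ℚ
signed true q = - q
signed false q = q

j : (k : ℕ) → G k → ℚ
j k τ = - ((_/_ (+ 1) (2 ^ k) {{nz k}}) *ℚ sumℚ (map (λ σ → signed (dot σ τ) (F k σ)) (allG k)))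
  where
  open import Data.Nat using (NonZero)
  open import Data.Nat.Properties using (m^n≢0)
  nz : (k : ℕ) → NonZero (2 ^ k)
  nz k = m^n≢0 2 k

-- G_∞: 0/1-sequences (τ_i)_{i≥1} (index i ↦ τ (i-1)) with finitely many nonzero entries
FinSupp : (ℕ → Bool) → Set
FinSupp τ = ∃ λ B → ∀ i → B ≤ i → τ i ≡ false

p : (k : ℕ) → (ℕ → Bool) → G k
p k τ = tabulate (λ (i : Fin k) → τ (toℕ i))

-- a rational sequence is Cauchy (⇔ convergent in ℝ)
Cauchy : (ℕ → ℚ) → Set
Cauchy a = ∀ (ε : ℚ) → 0ℚ <ℚ ε → ∃ λ N → ∀ m n → N ≤ m → N ≤ n → ∣ a m -ℚ a n ∣ <ℚ ε

{-# OPTIONS --safe #-}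
-- Write j_k(t) = -2^{-k} W_k(t, F_k) with the Walsh sum W_k(t, g) = Σ_σ (-1)^{σ·t} g(σ).
-- Appending a zero to t pairs σ0 with σ1, so W_{k+1}(t0, g) = W_k(t, s ↦ g(2s) + g(2s+1)),
-- and since F_{k+1}(2s) = F_k(s) this gives j_{k+1}(t0) - j_k(t) = -2^{-(k+1)} W_k(t, δ_k) with
-- δ_k(s) = F_{k+1}(2s+1) - F_k(s). Now F_{k+1}(2s+1) is the mediant of the neighbouring Farey
-- fractions F_k(s) ≤ F_k(s+1), so 0 ≤ δ_k(s) ≤ F_k(s+1) - F_k(s), and these bounds telescope to
-- F_k(2^k) - F_k(0) = 1. Once τ has vanished, consecutive terms therefore differ by at most
-- 2^{-(k+1)}, and the sequence is Cauchy.
module Submission where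

open import Defs
open import Data.Bool using (Bool; true; false; _xor_)
open import Data.Nat as ℕ using (ℕ; zero; suc; _^_; NonZero)
import Data.Nat.Properties as ℕ
open import Data.Nat.Tactic.RingSolver using (solve-∀)
import Data.Integer as ℤ
import Data.Integer.Properties as ℤ
open import Data.List using (List; []; _∷_; map; _++_)
open import Data.Vec using ([]; _∷_; _∷ʳ_)
open import Data.Product using (_×_; _,_; ∃)
open import Data.Sum using (inj₁; inj₂)
open import Relation.Binary.PropositionalEquality

module _ where
  open import Data.Nat
  open import Data.Nat.Properties

  data Halving : ℕ → Set where
    even : ∀ m → Halving (m + m)
    odd  : ∀ m → Halving (suc (m + m))

  halving : ∀ n → Halving n
  halving zero = even 0
  halving (suc n) with halving n
  ... | even m = odd m
  ... | odd m  = subst Halving (cong suc (+-suc m m)) (even (suc m))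

  isOdd-double : ∀ m → isOdd (m + m) ≡ false
  isOdd-double zero = refl
  isOdd-double (suc m) rewrite +-suc m m | isOdd-double m = refl

  hr-double : ∀ k m → hr (suc k) (m + m) ≡ hr k m
  hr-double k m with isOdd (m + m) | isOdd-double m
  ... | false | _ = cong (hr k) (sym (n≡⌊n+n/2⌋ m))

  hr-double+1 : ∀ k m →
    hr (suc k) (suc (m + m)) ≡ (hhat k m + hhat k (suc m) , rhat k m + rhat k (suc m))
  hr-double+1 k m with isOdd (m + m) | isOdd-double m
  ... | false | _ rewrite sym (n≡⌈n+n/2⌉ m) = refl

  hr-double+2 : ∀ k m → hr (suc k) (suc (suc (m + m))) ≡ hr k (suc m)
  hr-double+2 k m =
    subst (λ n → hr (suc k) n ≡ hr k (suc m)) (cong suc (+-suc m m)) (hr-double k (suc m))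

  hr-0 : ∀ k → hr k 0 ≡ (1 , 0)
  hr-0 zero    = refl
  hr-0 (suc k) = trans (hr-double k 0) (hr-0 k)

  2^suc : ∀ k → 2 ^ suc k ≡ 2 ^ k + 2 ^ k
  2^suc k = cong (2 ^ k +_) (+-identityʳ (2 ^ k))

  hr-2^ : ∀ k → hr k (2 ^ k) ≡ (1 , 1)
  hr-2^ zero    = refl
  hr-2^ (suc k) = trans (cong (hr (suc k)) (2^suc k)) (trans (hr-double k (2 ^ k)) (hr-2^ k))

  hhat>0 : ∀ k s → 0 < hhat k s
  hhat>0 zero    zero          = z<s
  hhat>0 zero    (suc zero)    = z<s
  hhat>0 zero    (suc (suc _)) = z<s
  hhat>0 (suc k) s with halving s
  ... | even m rewrite hr-double k m   = hhat>0 k m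
  ... | odd m  rewrite hr-double+1 k m = ≤-trans (hhat>0 k m) (m≤m+n _ _)

  ≤-mediant : ∀ h₁ r₁ h₂ r₂ → r₁ * h₂ ≤ r₂ * h₁ → r₁ * (h₁ + h₂) ≤ (r₁ + r₂) * h₁
  ≤-mediant h₁ r₁ h₂ r₂ le = begin
    r₁ * (h₁ + h₂)    ≡⟨ *-distribˡ-+ r₁ h₁ h₂ ⟩
    r₁ * h₁ + r₁ * h₂ ≤⟨ +-monoʳ-≤ (r₁ * h₁) le ⟩
    r₁ * h₁ + r₂ * h₁ ≡⟨ *-distribʳ-+ h₁ r₁ r₂ ⟨
    (r₁ + r₂) * h₁    ∎
    where open ≤-Reasoning

  mediant-≤ : ∀ h₁ r₁ h₂ r₂ → r₁ * h₂ ≤ r₂ * h₁ → (r₁ + r₂) * h₂ ≤ r₂ * (h₁ + h₂)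
  mediant-≤ h₁ r₁ h₂ r₂ le = begin
    (r₁ + r₂) * h₂    ≡⟨ *-distribʳ-+ h₂ r₁ r₂ ⟩
    r₁ * h₂ + r₂ * h₂ ≤⟨ +-monoˡ-≤ (r₂ * h₂) le ⟩
    r₂ * h₁ + r₂ * h₂ ≡⟨ *-distribˡ-+ r₂ h₁ h₂ ⟨
    r₂ * (h₁ + h₂)    ∎
    where open ≤-Reasoning

  halve-<2^suc : ∀ {m} k → m + m < 2 ^ suc k → m < 2 ^ k
  halve-<2^suc {m} k lt = ≰⇒> λ 2^k≤m → <⇒≱ (subst (m + m <_) (2^suc k) lt) (+-mono-≤ 2^k≤m 2^k≤m)

  hr-mono : ∀ k s → s < 2 ^ k → rhat k s * hhat k (suc s) ≤ rhat k (suc s) * hhat k s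
  hr-mono zero    zero    _         = z≤n
  hr-mono zero    (suc s) (s≤s ())
  hr-mono (suc k) s lt with halving s
  ... | even m rewrite hr-double k m   | hr-double+1 k m =
    ≤-mediant (hhat k m) (rhat k m) (hhat k (suc m)) (rhat k (suc m))
      (hr-mono k m (halve-<2^suc k lt))
  ... | odd m  rewrite hr-double+1 k m | hr-double+2 k m =
    mediant-≤ (hhat k m) (rhat k m) (hhat k (suc m)) (rhat k (suc m))
      (hr-mono k m (halve-<2^suc k (<-trans (n<1+n _) lt)))

  n<2^n : ∀ n → n < 2 ^ n
  n<2^n zero    = z<s
  n<2^n (suc n) = subst (_< 2 ^ suc n) (+-comm n 1)
    (+-mono-<-≤ (n<2^n n) (≤-trans (m^n>0 2 n) (m≤m+n _ _)))

open import Data.Rational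
  using (ℚ; mkℚ; 0ℚ; 1ℚ; _/_; -_; ∣_∣; _+_; _*_; _-_; _≤_; _<_; *<*; toℚᵘ; nonNegative)
open import Data.Rational.Properties
import Data.Rational.Unnormalised as ℚᵘ
import Data.Rational.Unnormalised.Properties as ℚᵘ
open import Data.Rational.Solver using (module +-*-Solver)
open +-*-Solver using (solve; _:+_; _:-_; :-_; _:*_; _:=_)

∣p-q∣≡∣q-p∣ : ∀ p q → ∣ p - q ∣ ≡ ∣ q - p ∣
∣p-q∣≡∣q-p∣ p q = trans (cong ∣_∣ (solve 2 (λ u v → u :- v := :- (v :- u)) refl p q)) (∣-p∣≡∣p∣ (q - p))

∣p-r∣≤∣p-q∣+∣q-r∣ : ∀ p q r → ∣ p - r ∣ ≤ ∣ p - q ∣ + ∣ q - r ∣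
∣p-r∣≤∣p-q∣+∣q-r∣ p q r = subst (λ x → ∣ x ∣ ≤ ∣ p - q ∣ + ∣ q - r ∣)
  (solve 3 (λ u v w → (u :- v) :+ (v :- w) := u :- w) refl p q r)
  (∣p+q∣≤∣p∣+∣q∣ (p - q) (q - r))

p≤q⇒0≤q-p : ∀ {p q} → p ≤ q → 0ℚ ≤ q - p
p≤q⇒0≤q-p {p} {q} p≤q = subst (_≤ q - p) (+-inverseʳ p) (+-monoˡ-≤ (- p) p≤q)

0≤q⇒p-q≤p : ∀ p {q} → 0ℚ ≤ q → p - q ≤ p
0≤q⇒p-q≤p p 0≤q = subst (p - _ ≤_) (+-identityʳ p) (+-monoʳ-≤ p (neg-antimono-≤ 0≤q))

toℚᵘ-/ : ∀ i n .{{_ : NonZero n}} → toℚᵘ (i / n) ℚᵘ.≃ (i ℚᵘ./ n)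
toℚᵘ-/ i (suc n) = toℚᵘ-fromℚᵘ (ℚᵘ.mkℚᵘ i n)

/-mono-≤ : ∀ {m₁ n₁ m₂ n₂} .{{_ : NonZero n₁}} .{{_ : NonZero n₂}} →
           m₁ ℕ.* n₂ ℕ.≤ m₂ ℕ.* n₁ → ℤ.+ m₁ / n₁ ≤ ℤ.+ m₂ / n₂
/-mono-≤ {m₁} {n₁@(suc _)} {m₂} {n₂@(suc _)} le = toℚᵘ-cancel-≤ (begin
  toℚᵘ (ℤ.+ m₁ / n₁) ≃⟨ toℚᵘ-/ (ℤ.+ m₁) n₁ ⟩
  ℤ.+ m₁ ℚᵘ./ n₁     ≤⟨ ℚᵘ.*≤* (subst₂ ℤ._≤_ (ℤ.pos-* m₁ n₂) (ℤ.pos-* m₂ n₁) (ℤ.+≤+ le)) ⟩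
  ℤ.+ m₂ ℚᵘ./ n₂     ≃⟨ toℚᵘ-/ (ℤ.+ m₂) n₂ ⟨
  toℚᵘ (ℤ.+ m₂ / n₂) ∎)
  where open ℚᵘ.≤-Reasoning

/-mono-< : ∀ {m₁ n₁ m₂ n₂} .{{_ : NonZero n₁}} .{{_ : NonZero n₂}} →
           m₁ ℕ.* n₂ ℕ.< m₂ ℕ.* n₁ → ℤ.+ m₁ / n₁ < ℤ.+ m₂ / n₂
/-mono-< {m₁} {n₁@(suc _)} {m₂} {n₂@(suc _)} lt = toℚᵘ-cancel-< (begin-strict
  toℚᵘ (ℤ.+ m₁ / n₁) ≃⟨ toℚᵘ-/ (ℤ.+ m₁) n₁ ⟩
  ℤ.+ m₁ ℚᵘ./ n₁     <⟨ ℚᵘ.*<* (subst₂ ℤ._<_ (ℤ.pos-* m₁ n₂) (ℤ.pos-* m₂ n₁) (ℤ.+<+ lt)) ⟩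
  ℤ.+ m₂ ℚᵘ./ n₂     ≃⟨ toℚᵘ-/ (ℤ.+ m₂) n₂ ⟨
  toℚᵘ (ℤ.+ m₂ / n₂) ∎)
  where open ℚᵘ.≤-Reasoning

divℕ-mono-≤ : ∀ {r₁ h₁ r₂ h₂} → 0 ℕ.< h₁ → 0 ℕ.< h₂ →
              r₁ ℕ.* h₂ ℕ.≤ r₂ ℕ.* h₁ → divℕ r₁ h₁ ≤ divℕ r₂ h₂
divℕ-mono-≤ {r₁} {suc h₁} {r₂} {suc h₂} _ _ = /-mono-≤ {r₁} {suc h₁} {r₂} {suc h₂}

/-double : ∀ n .{{_ : NonZero n}} →
           (ℤ.+ 1 / (2 ℕ.* n)) {{ℕ.m*n≢0 2 n}} + (ℤ.+ 1 / (2 ℕ.* n)) {{ℕ.m*n≢0 2 n}} ≡ ℤ.+ 1 / n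
/-double n@(suc m) = toℚᵘ-injective (begin
  toℚᵘ (x + x)       ≈⟨ toℚᵘ-homo-+ x x ⟩
  toℚᵘ x ℚᵘ.+ toℚᵘ x ≈⟨ ℚᵘ.+-cong (toℚᵘ-/ (ℤ.+ 1) (2 ℕ.* n)) (toℚᵘ-/ (ℤ.+ 1) (2 ℕ.* n)) ⟩
  u ℚᵘ.+ u           ≈⟨ ℚᵘ.*≡* (cong ℤ.+_ (cross m)) ⟩
  ℤ.+ 1 ℚᵘ./ n       ≈⟨ toℚᵘ-/ (ℤ.+ 1) n ⟨
  toℚᵘ (ℤ.+ 1 / n)   ∎)
  where
  open ℚᵘ.≃-Reasoning
  x = ℤ.+ 1 / (2 ℕ.* n)
  u = ℤ.+ 1 ℚᵘ./ (2 ℕ.* n)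
  cross : ∀ m → let d = 2 ℕ.* suc m in (1 ℕ.* d ℕ.+ 1 ℕ.* d) ℕ.* suc m ≡ 1 ℕ.* (d ℕ.* d)
  cross = solve-∀

½^_ : ℕ → ℚ
½^ k = (ℤ.+ 1 / 2 ^ k) {{ℕ.m^n≢0 2 k}}

½^-double : ∀ k → ½^ suc k + ½^ suc k ≡ ½^ k
½^-double k = /-double (2 ^ k) {{ℕ.m^n≢0 2 k}}

½^-nonNeg : ∀ k → 0ℚ ≤ ½^ k
½^-nonNeg k = nonNegative⁻¹ (½^ k) {{normalize-nonNeg 1 (2 ^ k) {{ℕ.m^n≢0 2 k}}}}

½^-antitone : ∀ {m n} → m ℕ.≤ n → ½^ n ≤ ½^ m
½^-antitone {m} {n} m≤n = /-mono-≤ {1} {2 ^ n} {1} {2 ^ m} {{ℕ.m^n≢0 2 n}} {{ℕ.m^n≢0 2 m}}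
  (ℕ.*-monoʳ-≤ 1 (ℕ.^-monoʳ-≤ 2 m≤n))

½^-small : ∀ ε → 0ℚ < ε → ∃ λ N → ½^ N < ε
-- ε = (n+1)/(d+1) ≥ 1/(d+1) > 1/2^(d+1)
½^-small ε@(mkℚ ℤ.+[1+ n ] d _) _ = suc d , subst (½^ suc d <_) (↥p/↧p≡p ε)
  (/-mono-< {1} {2 ^ suc d} {suc n} {suc d} {{ℕ.m^n≢0 2 (suc d)}} cross)
  where
  cross : 1 ℕ.* suc d ℕ.< suc n ℕ.* 2 ^ suc d
  cross = ℕ.<-≤-trans (subst (ℕ._< 2 ^ suc d) (sym (ℕ.*-identityˡ (suc d))) (n<2^n (suc d)))
                      (ℕ.m≤n*m (2 ^ suc d) (suc n))
½^-small (mkℚ ℤ.+0        _ _) (*<* (ℤ.+<+ ()))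
½^-small (mkℚ ℤ.-[1+ _ ] _ _) (*<* ())

HalvingSteps : (ℕ → ℚ) → ℕ → Set
HalvingSteps a B = ∀ k → B ℕ.≤ k → ∣ a (suc k) - a k ∣ ≤ ½^ suc k

HalvingSteps⇒drift : ∀ a {B} → HalvingSteps a B →
                     ∀ d {m} → B ℕ.≤ m → ∣ a (d ℕ.+ m) - a m ∣ ≤ ½^ m - ½^ (d ℕ.+ m)
HalvingSteps⇒drift a steps zero {m} _ =
  ≤-reflexive (trans (cong ∣_∣ (+-inverseʳ (a m))) (sym (+-inverseʳ (½^ m))))
HalvingSteps⇒drift a steps (suc d) {m} B≤m = begin
  ∣ a (suc n) - a m ∣                        ≤⟨ ∣p-r∣≤∣p-q∣+∣q-r∣ (a (suc n)) (a n) (a m) ⟩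
  ∣ a (suc n) - a n ∣ + ∣ a n - a m ∣        ≤⟨ +-mono-≤ (steps n (ℕ.≤-trans B≤m (ℕ.m≤n+m m d)))
                                                         (HalvingSteps⇒drift a steps d B≤m) ⟩
  ½^ suc n + (½^ m - ½^ n)                   ≡⟨ cong (λ x → ½^ suc n + (½^ m - x)) (½^-double n) ⟨
  ½^ suc n + (½^ m - (½^ suc n + ½^ suc n)) ≡⟨ solve 2 (λ u v → u :+ (v :- (u :+ u)) := v :- u) refl
                                                        (½^ suc n) (½^ m) ⟩
  ½^ m - ½^ suc n                            ∎
  where
  open ≤-Reasoning
  n = d ℕ.+ m

HalvingSteps⇒near : ∀ a {B} → HalvingSteps a B → ∀ {m n} → B ℕ.≤ m → m ℕ.≤ n → ∣ a n - a m ∣ ≤ ½^ m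
HalvingSteps⇒near a steps {m} {n} B≤m m≤n = subst (λ x → ∣ a x - a m ∣ ≤ ½^ m) (ℕ.m∸n+n≡m m≤n)
  (≤-trans (HalvingSteps⇒drift a steps (n ℕ.∸ m) B≤m) (0≤q⇒p-q≤p (½^ m) (½^-nonNeg (n ℕ.∸ m ℕ.+ m))))

HalvingSteps⇒Cauchy : ∀ a {B} → HalvingSteps a B → Cauchy a
HalvingSteps⇒Cauchy a {B} steps ε 0<ε with ½^-small ε 0<ε
... | N₀ , ½^N₀<ε = B ℕ.⊔ N₀ , close
  where
  near : ∀ {m n} → B ℕ.⊔ N₀ ℕ.≤ m → m ℕ.≤ n → ∣ a n - a m ∣ < ε
  near N≤m m≤n = ≤-<-trans (HalvingSteps⇒near a steps (ℕ.m⊔n≤o⇒m≤o B N₀ N≤m) m≤n)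
                           (≤-<-trans (½^-antitone (ℕ.m⊔n≤o⇒n≤o B N₀ N≤m)) ½^N₀<ε)
  close : ∀ m n → B ℕ.⊔ N₀ ℕ.≤ m → B ℕ.⊔ N₀ ℕ.≤ n → ∣ a m - a n ∣ < ε
  close m n N≤m N≤n with ℕ.≤-total m n
  ... | inj₁ m≤n = subst (_< ε) (∣p-q∣≡∣q-p∣ (a n) (a m)) (near N≤m m≤n)
  ... | inj₂ n≤m = near N≤n n≤m

∑< : ℕ → (ℕ → ℚ) → ℚ
∑< zero    g = 0ℚ
∑< (suc n) g = ∑< n g + g n

∑<-+ : ∀ m n (g : ℕ → ℚ) → ∑< (m ℕ.+ n) g ≡ ∑< m g + ∑< n (λ s → g (m ℕ.+ s))
∑<-+ m zero    g rewrite ℕ.+-identityʳ m = sym (+-identityʳ (∑< m g))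
∑<-+ m (suc n) g rewrite ℕ.+-suc m n | ∑<-+ m n g = +-assoc (∑< m g) _ _

∑<-mono : ∀ n {f g : ℕ → ℚ} → (∀ s → s ℕ.< n → f s ≤ g s) → ∑< n f ≤ ∑< n g
∑<-mono zero    f≤g = ≤-refl
∑<-mono (suc n) f≤g = +-mono-≤ (∑<-mono n (λ s lt → f≤g s (ℕ.m<n⇒m<1+n lt))) (f≤g n (ℕ.n<1+n n))

∑<-telescope : ∀ n (g : ℕ → ℚ) → ∑< n (λ s → g (suc s) - g s) ≡ g n - g 0
∑<-telescope zero    g = sym (+-inverseʳ (g 0))
∑<-telescope (suc n) g rewrite ∑<-telescope n g =
  solve 3 (λ a b c → (b :- a) :+ (c :- b) := c :- a) refl (g 0) (g n) (g (suc n))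

∑ : {A : Set} → List A → (A → ℚ) → ℚ
∑ xs f = sumℚ (map f xs)

∑-++ : {A : Set} (xs ys : List A) (f : A → ℚ) → ∑ (xs ++ ys) f ≡ ∑ xs f + ∑ ys f
∑-++ []       ys f = sym (+-identityˡ _)
∑-++ (x ∷ xs) ys f = trans (cong (f x +_) (∑-++ xs ys f)) (sym (+-assoc (f x) _ _))

∑-map : {A B : Set} (xs : List A) (h : A → B) (f : B → ℚ) → ∑ (map h xs) f ≡ ∑ xs (λ x → f (h x))
∑-map []       h f = refl
∑-map (x ∷ xs) h f = cong (f (h x) +_) (∑-map xs h f)

∑-cong : {A : Set} (xs : List A) {f g : A → ℚ} → (∀ x → f x ≡ g x) → ∑ xs f ≡ ∑ xs g
∑-cong []       f≡g = refl
∑-cong (x ∷ xs) f≡g = cong₂ _+_ (f≡g x) (∑-cong xs f≡g)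

∑-+ : {A : Set} (xs : List A) (f g : A → ℚ) → ∑ xs (λ x → f x + g x) ≡ ∑ xs f + ∑ xs g
∑-+ []       f g = refl
∑-+ (x ∷ xs) f g rewrite ∑-+ xs f g =
  solve 4 (λ a b c d → (a :+ b) :+ (c :+ d) := (a :+ c) :+ (b :+ d)) refl (f x) (g x) (∑ xs f) (∑ xs g)

∑-neg : {A : Set} (xs : List A) (f : A → ℚ) → ∑ xs (λ x → - f x) ≡ - ∑ xs f
∑-neg []       f = refl
∑-neg (x ∷ xs) f rewrite ∑-neg xs f = sym (neg-distrib-+ (f x) (∑ xs f))

∑-signed : {A : Set} (xs : List A) (b : Bool) (f : A → ℚ) → ∑ xs (λ x → signed b (f x)) ≡ signed b (∑ xs f)
∑-signed xs false f = refl
∑-signed xs true  f = ∑-neg xs f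

signed-xor : ∀ b d x → signed (b xor d) x ≡ signed b (signed d x)
signed-xor false d     x = refl
signed-xor true  false x = refl
signed-xor true  true  x = solve 1 (λ y → y := :- (:- y)) refl x

signed-+ : ∀ b x y → signed b (x + y) ≡ signed b x + signed b y
signed-+ false x y = refl
signed-+ true  x y = neg-distrib-+ x y

∣signed∣ : ∀ b x → ∣ signed b x ∣ ≡ ∣ x ∣
∣signed∣ false x = refl
∣signed∣ true  x = ∣-p∣≡∣p∣ x

walsh : (k : ℕ) → G k → (ℕ → ℚ) → ℚ
walsh k t g = ∑ (allG k) (λ σ → signed (dot σ t) (g (toNat σ)))

walsh-cong : ∀ k t {f g : ℕ → ℚ} → (∀ s → f s ≡ g s) → walsh k t f ≡ walsh k t g
walsh-cong k t f≡g = ∑-cong (allG k) (λ σ → cong (signed (dot σ t)) (f≡g (toNat σ)))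

walsh-+ : ∀ k t (f g : ℕ → ℚ) → walsh k t (λ s → f s + g s) ≡ walsh k t f + walsh k t g
walsh-+ k t f g = trans (∑-cong (allG k) (λ σ → signed-+ (dot σ t) (f (toNat σ)) (g (toNat σ))))
                        (∑-+ (allG k) _ _)

walsh-∷ : ∀ k b t (g : ℕ → ℚ) →
  walsh (suc k) (b ∷ t) g ≡ walsh k t g + signed b (walsh k t (λ s → g (2 ^ k ℕ.+ s)))
walsh-∷ k b t g = begin
  walsh (suc k) (b ∷ t) g
    ≡⟨ ∑-++ (map (false ∷_) (allG k)) (map (true ∷_) (allG k)) term ⟩
  ∑ (map (false ∷_) (allG k)) term + ∑ (map (true ∷_) (allG k)) term
    ≡⟨ cong₂ _+_ (∑-map (allG k) (false ∷_) term) (∑-map (allG k) (true ∷_) term) ⟩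
  walsh k t g + ∑ (allG k) (λ σ → signed (b xor dot σ t) (g (2 ^ k ℕ.+ toNat σ)))
    ≡⟨ cong (walsh k t g +_) (trans (∑-cong (allG k) (λ σ → signed-xor b (dot σ t) _))
                                    (∑-signed (allG k) b _)) ⟩
  walsh k t g + signed b (walsh k t (λ s → g (2 ^ k ℕ.+ s))) ∎
  where
  open ≡-Reasoning
  term : G (suc k) → ℚ
  term σ = signed (dot σ (b ∷ t)) (g (toNat σ))

walsh-∷ʳ-false : ∀ k t (g : ℕ → ℚ) →
  walsh (suc k) (t ∷ʳ false) g ≡ walsh k t (λ s → g (s ℕ.+ s) + g (suc (s ℕ.+ s)))
walsh-∷ʳ-false zero    []      g = trans (cong (g 0 +_) (+-identityʳ (g 1))) (sym (+-identityʳ (g 0 + g 1)))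
walsh-∷ʳ-false (suc k) (b ∷ t) g = begin
  walsh (suc (suc k)) (b ∷ (t ∷ʳ false)) g
    ≡⟨ walsh-∷ (suc k) b (t ∷ʳ false) g ⟩
  walsh (suc k) (t ∷ʳ false) g + signed b (walsh (suc k) (t ∷ʳ false) (λ s → g (2 ^ suc k ℕ.+ s)))
    ≡⟨ cong₂ (λ x y → x + signed b y) (walsh-∷ʳ-false k t g)
                                      (walsh-∷ʳ-false k t (λ s → g (2 ^ suc k ℕ.+ s))) ⟩
  walsh k t pairs
    + signed b (walsh k t (λ s → g (2 ^ suc k ℕ.+ (s ℕ.+ s)) + g (2 ^ suc k ℕ.+ suc (s ℕ.+ s))))
    ≡⟨ cong (λ y → walsh k t pairs + signed b y) (walsh-cong k t (λ s → cong₂ _+_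
          (cong g (sym (double-shift (2 ^ k) s)))
          (cong g (trans (ℕ.+-suc (2 ^ suc k) (s ℕ.+ s)) (cong suc (sym (double-shift (2 ^ k) s))))))) ⟩
  walsh k t pairs + signed b (walsh k t (λ s → pairs (2 ^ k ℕ.+ s)))
    ≡⟨ walsh-∷ k b t pairs ⟨
  walsh (suc k) (b ∷ t) pairs ∎
  where
  open ≡-Reasoning
  pairs : ℕ → ℚ
  pairs s = g (s ℕ.+ s) + g (suc (s ℕ.+ s))
  double-shift : ∀ x s → (x ℕ.+ s) ℕ.+ (x ℕ.+ s) ≡ 2 ℕ.* x ℕ.+ (s ℕ.+ s)
  double-shift = solve-∀

∣walsh∣≤ : ∀ k t (g : ℕ → ℚ) → ∣ walsh k t g ∣ ≤ ∑< (2 ^ k) (λ s → ∣ g s ∣)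
∣walsh∣≤ zero    []      g = ≤-reflexive (trans (cong ∣_∣ (+-identityʳ (g 0))) (sym (+-identityˡ _)))
∣walsh∣≤ (suc k) (b ∷ t) g = begin
  ∣ walsh (suc k) (b ∷ t) g ∣
    ≡⟨ cong ∣_∣ (walsh-∷ k b t g) ⟩
  ∣ walsh k t g + signed b (walsh k t shifted) ∣
    ≤⟨ ∣p+q∣≤∣p∣+∣q∣ (walsh k t g) _ ⟩
  ∣ walsh k t g ∣ + ∣ signed b (walsh k t shifted) ∣
    ≡⟨ cong (∣ walsh k t g ∣ +_) (∣signed∣ b (walsh k t shifted)) ⟩
  ∣ walsh k t g ∣ + ∣ walsh k t shifted ∣
    ≤⟨ +-mono-≤ (∣walsh∣≤ k t g) (∣walsh∣≤ k t shifted) ⟩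
  ∑< (2 ^ k) (λ s → ∣ g s ∣) + ∑< (2 ^ k) (λ s → ∣ shifted s ∣)
    ≡⟨ ∑<-+ (2 ^ k) (2 ^ k) (λ s → ∣ g s ∣) ⟨
  ∑< (2 ^ k ℕ.+ 2 ^ k) (λ s → ∣ g s ∣)
    ≡⟨ cong (λ n → ∑< n (λ s → ∣ g s ∣)) (2^suc k) ⟨
  ∑< (2 ^ suc k) (λ s → ∣ g s ∣) ∎
  where
  open ≤-Reasoning
  shifted : ℕ → ℚ
  shifted s = g (2 ^ k ℕ.+ s)

fraction : ℕ × ℕ → ℚ
fraction (h , r) = divℕ r h

Farey : ℕ → ℕ → ℚ
Farey k s = fraction (hr k s)

Farey-0 : ∀ k → Farey k 0 ≡ 0ℚ
Farey-0 k = cong fraction (hr-0 k)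

Farey-2^ : ∀ k → Farey k (2 ^ k) ≡ 1ℚ
Farey-2^ k = cong fraction (hr-2^ k)

Farey-double : ∀ k s → Farey (suc k) (s ℕ.+ s) ≡ Farey k s
Farey-double k s = cong fraction (hr-double k s)

Farey≤mediant : ∀ k s → s ℕ.< 2 ^ k → Farey k s ≤ Farey (suc k) (suc (s ℕ.+ s))
Farey≤mediant k s lt = subst (Farey k s ≤_) (sym (cong fraction (hr-double+1 k s)))
  (divℕ-mono-≤ (hhat>0 k s) (ℕ.<-≤-trans (hhat>0 k s) (ℕ.m≤m+n _ _))
    (≤-mediant (hhat k s) (rhat k s) (hhat k (suc s)) (rhat k (suc s)) (hr-mono k s lt)))

mediant≤Farey : ∀ k s → s ℕ.< 2 ^ k → Farey (suc k) (suc (s ℕ.+ s)) ≤ Farey k (suc s)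
mediant≤Farey k s lt = subst (_≤ Farey k (suc s)) (sym (cong fraction (hr-double+1 k s)))
  (divℕ-mono-≤ (ℕ.<-≤-trans (hhat>0 k s) (ℕ.m≤m+n _ _)) (hhat>0 k (suc s))
    (mediant-≤ (hhat k s) (rhat k s) (hhat k (suc s)) (rhat k (suc s)) (hr-mono k s lt)))

Farey-gap : ℕ → ℕ → ℚ
Farey-gap k s = Farey (suc k) (suc (s ℕ.+ s)) - Farey k s

∣Farey-gap∣≤ : ∀ k s → s ℕ.< 2 ^ k → ∣ Farey-gap k s ∣ ≤ Farey k (suc s) - Farey k s
∣Farey-gap∣≤ k s lt = subst (_≤ Farey k (suc s) - Farey k s)
  (sym (0≤p⇒∣p∣≡p (p≤q⇒0≤q-p (Farey≤mediant k s lt))))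
  (+-monoˡ-≤ (- Farey k s) (mediant≤Farey k s lt))

∑∣Farey-gap∣≤1 : ∀ k → ∑< (2 ^ k) (λ s → ∣ Farey-gap k s ∣) ≤ 1ℚ
∑∣Farey-gap∣≤1 k = ≤-trans (∑<-mono (2 ^ k) (∣Farey-gap∣≤ k))
  (≤-reflexive (trans (∑<-telescope (2 ^ k) (Farey k)) (cong₂ _-_ (Farey-2^ k) (Farey-0 k))))

j≡walsh : ∀ k t → j k t ≡ - (½^ k * walsh k t (Farey k))
j≡walsh k t = refl

walsh-refine : ∀ k t → walsh (suc k) (t ∷ʳ false) (Farey (suc k))
                     ≡ (walsh k t (Farey k) + walsh k t (Farey k)) + walsh k t (Farey-gap k)
walsh-refine k t = begin
  walsh (suc k) (t ∷ʳ false) (Farey (suc k))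
    ≡⟨ walsh-∷ʳ-false k t (Farey (suc k)) ⟩
  walsh k t (λ s → Farey (suc k) (s ℕ.+ s) + Farey (suc k) (suc (s ℕ.+ s)))
    ≡⟨ walsh-cong k t split ⟩
  walsh k t (λ s → (Farey k s + Farey k s) + Farey-gap k s)
    ≡⟨ walsh-+ k t (λ s → Farey k s + Farey k s) (Farey-gap k) ⟩
  walsh k t (λ s → Farey k s + Farey k s) + walsh k t (Farey-gap k)
    ≡⟨ cong (_+ walsh k t (Farey-gap k)) (walsh-+ k t (Farey k) (Farey k)) ⟩
  (walsh k t (Farey k) + walsh k t (Farey k)) + walsh k t (Farey-gap k) ∎
  where
  open ≡-Reasoning
  split : ∀ s → Farey (suc k) (s ℕ.+ s) + Farey (suc k) (suc (s ℕ.+ s))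
              ≡ (Farey k s + Farey k s) + Farey-gap k s
  split s rewrite Farey-double k s =
    solve 2 (λ a m → a :+ m := (a :+ a) :+ (m :- a)) refl (Farey k s) (Farey (suc k) (suc (s ℕ.+ s)))

j-∷ʳ-false : ∀ k t → j (suc k) (t ∷ʳ false) - j k t ≡ - (½^ suc k * walsh k t (Farey-gap k))
j-∷ʳ-false k t = begin
  j (suc k) (t ∷ʳ false) - j k t
    ≡⟨ cong₂ _-_ (j≡walsh (suc k) (t ∷ʳ false)) (j≡walsh k t) ⟩
  - (c * walsh (suc k) (t ∷ʳ false) (Farey (suc k))) - - (½^ k * X)
    ≡⟨ cong (λ w → - (c * w) - - (½^ k * X)) (walsh-refine k t) ⟩
  - (c * ((X + X) + Y)) - - (½^ k * X)
    ≡⟨ cong (λ z → - (c * ((X + X) + Y)) - - (z * X)) (½^-double k) ⟨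
  - (c * ((X + X) + Y)) - - ((c + c) * X)
    ≡⟨ solve 3 (λ a x y → :- (a :* ((x :+ x) :+ y)) :- :- ((a :+ a) :* x) := :- (a :* y)) refl c X Y ⟩
  - (c * Y) ∎
  where
  open ≡-Reasoning
  c = ½^ suc k
  X = walsh k t (Farey k)
  Y = walsh k t (Farey-gap k)

∣j-∷ʳ-false∣≤ : ∀ k t → ∣ j (suc k) (t ∷ʳ false) - j k t ∣ ≤ ½^ suc k
∣j-∷ʳ-false∣≤ k t = begin
  ∣ j (suc k) (t ∷ʳ false) - j k t ∣ ≡⟨ cong ∣_∣ (j-∷ʳ-false k t) ⟩
  ∣ - (c * Y) ∣                     ≡⟨ ∣-p∣≡∣p∣ (c * Y) ⟩
  ∣ c * Y ∣                         ≡⟨ ∣p*q∣≡∣p∣*∣q∣ c Y ⟩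
  ∣ c ∣ * ∣ Y ∣                     ≡⟨ cong (_* ∣ Y ∣) (0≤p⇒∣p∣≡p (½^-nonNeg (suc k))) ⟩
  c * ∣ Y ∣                         ≤⟨ *-monoˡ-≤-nonNeg c {{nonNegative (½^-nonNeg (suc k))}} ∣Y∣≤1 ⟩
  c * 1ℚ                            ≡⟨ *-identityʳ c ⟩
  c                                 ∎
  where
  open ≤-Reasoning
  c = ½^ suc k
  Y = walsh k t (Farey-gap k)
  ∣Y∣≤1 : ∣ Y ∣ ≤ 1ℚ
  ∣Y∣≤1 = ≤-trans (∣walsh∣≤ k t (Farey-gap k)) (∑∣Farey-gap∣≤1 k)

p-suc : ∀ k (τ : ℕ → Bool) → p (suc k) τ ≡ p k τ ∷ʳ τ k
p-suc zero    τ = refl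
p-suc (suc k) τ = cong (τ 0 ∷_) (p-suc k (λ i → τ (suc i)))

proposition4p5 : (τ : ℕ → Bool) → FinSupp τ → Cauchy (λ k → j k (p k τ))
proposition4p5 τ (B , τ-vanishes) = HalvingSteps⇒Cauchy (λ k → j k (p k τ)) steps
  where
  steps : HalvingSteps (λ k → j k (p k τ)) B
  steps k B≤k rewrite p-suc k τ | τ-vanishes k B≤k = ∣j-∷ʳ-false∣≤ k (p k τ)
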